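{- Let $F$ be a graph, let $W$ be the condensation of $F$ with respect to an indexed partition $\{U_1,\ldots,U_k\}$ of $V(F)$ into independent sets, and let $q=\max\{|U_1|,\ldots,|U_k|\}$. Then the $q$-blow up of $W$ has a fractional $F$-decomposition.
   Context: A weighted graph is a simple graph with positive real weights on its edges. The condensation of $F$ with respect to an indexed partition $\{U_1,\ldots,U_k\}$ of $V(F)$ into independent sets is the weighted graph on $\{1,\ldots,k\}$ in which edge $ij$ has weight equal to the number of edges of $F$ between $U_i$ and $U_j$ (absent if $0$). For a weighted graph $W$ and positive integer $q$, the $q$-blow up of $W$ is the weighted graph $Q$ with vertex set $V(W)\times\{1,\ldots,q\}$ in which, for all $i,j\in\{1,\ldots,q\}$, the edge $\{(x,i),(y,j)\}$ is present with weight $w_W(xy)$ if $xy\in E(W)$ and absent otherwise. A fractional $F$-decomposition of a weighted graph $Q$ is a finite collection of weighted graphs, each obtained from a copy of $F$ that is a subgraph of the underlying graph of $Q$ by assigning all its edges a common positive weight, such that for each edge $e$ of $Q$ the total weight assigned to $e$ is exactly $w_Q(e)$. -}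

module Defs where

open import Data.Nat using (ℕ; zero; suc; _+_; _⊔_)
open import Data.Bool using (Bool; true; false; _∧_; _∨_; if_then_else_)
open import Data.Fin using (Fin)
import Data.Fin as Fin
open import Data.Product using (_×_; _,_; Σ; ∃)
open import Data.List using (List; []; _∷_)
open import Data.Integer using (+_)
open import Data.Rational using (ℚ; Positive; _/_; 0ℚ) renaming (_+_ to _+ℚ_; _*_ to _*ℚ_)
open import Relation.Nullary.Decidable using (⌊_⌋)
open import Relation.Binary.PropositionalEquality using (_≡_; _≢_)
open import Function.Definitions using (Injective)
open import Function.Base using (_∘_)

sumFin : ∀ {n} → (Fin n → ℕ) → ℕ
sumFin {zero}  f = 0
sumFin {suc n} f = f Fin.zero + sumFin (f ∘ Fin.suc)

countFin : ∀ {n} → (Fin n → Bool) → ℕ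
countFin p = sumFin (λ i → if p i then 1 else 0)

maxFin : ∀ {n} → (Fin n → ℕ) → ℕ
maxFin {zero}  f = 0
maxFin {suc n} f = f Fin.zero ⊔ maxFin (f ∘ Fin.suc)

anyFin : ∀ {n} → (Fin n → Bool) → Bool
anyFin {zero}  p = false
anyFin {suc n} p = p Fin.zero ∨ anyFin (p ∘ Fin.suc)

_==_ : ∀ {n} → Fin n → Fin n → Bool
i == j = ⌊ i Fin.≟ j ⌋

record Graph (n : ℕ) : Set where
  field
    adj    : Fin n → Fin n → Bool
    sym    : ∀ u v → adj u v ≡ adj v u
    irrefl : ∀ u → adj u u ≡ false
open Graph public

-- Indexed partitions {U_1,…,U_k} of V(F) into independent sets,
-- given by the map part : V(F) → Fin k (U_i = part⁻¹(i)); parts nonempty.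

record IndepPartition {n : ℕ} (F : Graph n) (k : ℕ) : Set where
  field
    part     : Fin n → Fin k
    nonempty : ∀ i → ∃ λ u → part u ≡ i
    indep    : ∀ u v → adj F u v ≡ true → part u ≢ part v
open IndepPartition public

partSize : ∀ {n k} {F : Graph n} → IndepPartition F k → Fin k → ℕ
partSize P i = countFin (λ u → part P u == i)

maxPartSize : ∀ {n k} {F : Graph n} → IndepPartition F k → ℕ
maxPartSize {k = k} P = maxFin (partSize P)

-- Weighted graphs with natural-number weights: a weight function on
-- ordered pairs, where weight 0 means "no edge" (weights of present
-- edges are positive).  Only integer-weighted graphs arise here
-- (condensations and their blow ups).

record NWGraph (V : Set) : Set where
  field
    w      : V → V → ℕ
    wsym   : ∀ x y → w x y ≡ w y x
    wirr   : ∀ x → w x x ≡ 0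
open NWGraph public

-- Condensation W of F w.r.t. the partition: w(i,j) = number of edges of F
-- between U_i and U_j.  (As the U_i are independent, each edge uv with
-- u ∈ U_i, v ∈ U_j (i ≠ j) is counted exactly once by ordered pairs.)
condWeight : ∀ {n k} {F : Graph n} → IndepPartition F k → Fin k → Fin k → ℕ
condWeight {F = F} P i j =
  sumFin (λ u → countFin (λ v → adj F u v ∧ (part P u == i) ∧ (part P v == j)))

blowUpWeight : ∀ {k} → (Fin k → Fin k → ℕ) → (q : ℕ) → (Fin k × Fin q) → (Fin k × Fin q) → ℕ
blowUpWeight w q (x , a) (y , b) = w x y

-- One member: a copy of F in the underlying graph of Q (an injective map
-- φ : V(F) → V(Q) sending edges of F to edges of Q; the copy's edges are
-- the images φ(u)φ(v) of edges uv of F), with a common positive weight.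
record WeightedCopy {n : ℕ} (F : Graph n) {V : Set} (Q : NWGraph V) : Set where
  field
    emb     : Fin n → V
    emb-inj : Injective _≡_ _≡_ emb
    emb-hom : ∀ u v → adj F u v ≡ true → w Q (emb u) (emb v) ≢ 0
    weight  : ℚ
    weight+ : Positive weight
open WeightedCopy public

copyContains : ∀ {n} {F : Graph n} {V : Set} {Q : NWGraph V}
  → (V → V → Bool) → WeightedCopy F Q → V → V → Bool
copyContains {F = F} eqV C α β =
  anyFin (λ u → anyFin (λ v → adj F u v ∧ eqV (emb C u) α ∧ eqV (emb C v) β))

totalWeight : ∀ {n} {F : Graph n} {V : Set} {Q : NWGraph V}
  → (V → V → Bool) → List (WeightedCopy F Q) → V → V → ℚ
totalWeight eqV []       α β = 0ℚ
totalWeight eqV (C ∷ Cs) α β =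
  (if copyContains eqV C α β then weight C else 0ℚ) +ℚ totalWeight eqV Cs α β

ℕtoℚ : ℕ → ℚ
ℕtoℚ m = (+ m) / 1

FractionalDecomposition : ∀ {n} (F : Graph n) {V : Set} (Q : NWGraph V)
  → (V → V → Bool) → Set
FractionalDecomposition F Q eqV =
  Σ (List (WeightedCopy F Q)) λ Cs →
    ∀ α β → w Q α β ≢ 0 → totalWeight eqV Cs α β ≡ ℕtoℚ (w Q α β)

eqPair : ∀ {k q} → (Fin k × Fin q) → (Fin k × Fin q) → Bool
eqPair (x , a) (y , b) = (x == y) ∧ (a == b)

-- Let q ≥ |U_i| for all i, and number the vertices of each part U_i by their rank 0, …, |U_i| - 1
-- within it.  For every t : [k] → ℤ/q, the map sending u ∈ U_i to (i , rank u + t i) embeds F in the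
-- q-blow up Q of W: ranks within a part are distinct, and an edge uv of F contributes to the weight
-- of the pair of parts containing u and v.  An edge (x , a) (y , b) of Q has x ≠ y, as the parts are
-- independent, and an edge uv of F between U_x and U_y is sent onto it exactly when
-- t x = a - rank u and t y = b - rank v, that is, for q^(k-2) of the q^k maps t.  Hence
-- (x , a) (y , b) lies in q^(k-2) w(x , y) of the copies, and giving every copy the weight q²/q^k
-- covers it exactly w(x , y) times.

module Submission where

open import Defs hiding (sym)

open import Data.Bool using (Bool; true; false; _∧_; if_then_else_)
open import Data.Bool.Properties using (∧-conicalˡ; ∧-conicalʳ; ∨-zeroʳ; ¬-not)
open import Data.Empty using (⊥-elim)
open import Data.Fin using (Fin; zero; suc; toℕ; fromℕ<; _≟_)
import Data.Fin.Properties as FinP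
import Data.Integer as ℤ
open import Data.Integer using (1ℤ)
import Data.Integer.Properties as ℤP
import Data.Integer.Tactic.RingSolver as ℤ-Solver
open import Data.List using (List; []; _∷_; [_]; _++_; map; concat; tabulate)
import Data.List.Properties as ListP
open import Data.Nat as ℕ using (ℕ; zero; suc; _+_; _*_; _^_; _∸_; _≤_; _<_; NonZero)
open import Data.Nat.DivMod using (_%_; _mod_; m%n%n≡m%n; %-distribˡ-+; [m+n]%n≡m%n; m<n⇒m%n≡m)
open import Data.Nat.ListAction using () renaming (sum to sumList)
open import Data.Nat.ListAction.Properties using () renaming (sum-++ to sumList-++)
import Data.Nat.Properties as ℕP
open import Data.Nat.Tactic.RingSolver using (solve-∀)
open import Data.Product using (_×_; _,_; ∃; proj₁; proj₂)
open import Data.Product.Properties using (,-injective)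
open import Data.Rational using (ℚ; _/_; toℚᵘ; 0ℚ) renaming (_+_ to _+ℚ_; _*_ to _*ℚ_)
import Data.Rational.Properties as ℚP
open import Data.Rational.Unnormalised as ℚᵘ using (mkℚᵘ; *≡*; _≃_)
import Data.Rational.Unnormalised.Properties as ℚᵘP
import Data.Vec.Functional as V
open import Function.Base using (_∘_; flip; case_of_)
open import Function.Definitions using (Injective)
open import Relation.Binary.PropositionalEquality
  using (_≡_; _≢_; refl; sym; trans; cong; cong₂; subst; module ≡-Reasoning)
open import Relation.Nullary using (yes; no)

open import Algebra.Properties.Semiring.Sum ℕP.+-*-semiring
  using (sum; ∑-comm; *-distribˡ-sum; *-distribʳ-sum)

private
  variable
    m n : ℕ

⟦_⟧ : Bool → ℕ
⟦ b ⟧ = if b then 1 else 0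

⟦∧⟧-interchange : ∀ a p h p′ h′ → ⟦ a ∧ (p ∧ h) ∧ (p′ ∧ h′) ⟧ ≡ ⟦ a ∧ p ∧ p′ ⟧ * (⟦ h ⟧ * ⟦ h′ ⟧)
⟦∧⟧-interchange false _     _     _     _     = refl
⟦∧⟧-interchange true  false _     _     _     = refl
⟦∧⟧-interchange true  true  false false _     = refl
⟦∧⟧-interchange true  true  false true  _     = refl
⟦∧⟧-interchange true  true  true  false _     = refl
⟦∧⟧-interchange true  true  true  true  false = refl
⟦∧⟧-interchange true  true  true  true  true  = refl

sumFin-cong : {f g : Fin n → ℕ} → (∀ i → f i ≡ g i) → sumFin f ≡ sumFin g
sumFin-cong {zero}  f≗g = refl
sumFin-cong {suc n} f≗g = cong₂ _+_ (f≗g zero) (sumFin-cong (f≗g ∘ suc))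

sumFin≡sum : (f : Fin n → ℕ) → sumFin f ≡ sum f
sumFin≡sum {zero}  f = refl
sumFin≡sum {suc n} f = cong (f zero +_) (sumFin≡sum (f ∘ suc))

sumFin-zero : {f : Fin n → ℕ} → (∀ i → f i ≡ 0) → sumFin f ≡ 0
sumFin-zero {zero}  f≗0 = refl
sumFin-zero {suc n} f≗0 = cong₂ _+_ (f≗0 zero) (sumFin-zero (f≗0 ∘ suc))

sumFin-const : ∀ r → sumFin {n} (λ _ → r) ≡ n * r
sumFin-const {zero}  r = refl
sumFin-const {suc n} r = cong (r +_) (sumFin-const {n} r)

≤-sumFin : (f : Fin n → ℕ) (i : Fin n) → f i ≤ sumFin f
≤-sumFin f zero    = ℕP.m≤m+n (f zero) _
≤-sumFin f (suc i) = ℕP.≤-trans (≤-sumFin (f ∘ suc) i) (ℕP.m≤n+m _ (f zero))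

sumFin-comm : (f : Fin m → Fin n → ℕ) →
              sumFin (λ i → sumFin (f i)) ≡ sumFin (λ j → sumFin (λ i → f i j))
sumFin-comm f = begin
  sumFin (λ i → sumFin (f i))          ≡⟨ sumFin-cong (λ i → sumFin≡sum (f i)) ⟩
  sumFin (λ i → sum (f i))             ≡⟨ sumFin≡sum (λ i → sum (f i)) ⟩
  sum (λ i → sum (f i))                ≡⟨ ∑-comm f ⟩
  sum (λ j → sum (λ i → f i j))        ≡⟨ sumFin≡sum (λ j → sum (λ i → f i j)) ⟨
  sumFin (λ j → sum (λ i → f i j))     ≡⟨ sumFin-cong (λ j → sumFin≡sum (λ i → f i j)) ⟨
  sumFin (λ j → sumFin (λ i → f i j))  ∎
  where open ≡-Reasoning

*-distribˡ-sumFin : ∀ r (f : Fin n → ℕ) → r * sumFin f ≡ sumFin (λ i → r * f i)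
*-distribˡ-sumFin r f = begin
  r * sumFin f                ≡⟨ cong (r *_) (sumFin≡sum f) ⟩
  r * sum f                   ≡⟨ *-distribˡ-sum r f ⟩
  sum (λ i → r * f i)         ≡⟨ sumFin≡sum (λ i → r * f i) ⟨
  sumFin (λ i → r * f i)      ∎
  where open ≡-Reasoning

*-distribʳ-sumFin : ∀ r (f : Fin n → ℕ) → sumFin f * r ≡ sumFin (λ i → f i * r)
*-distribʳ-sumFin r f = begin
  sumFin f * r                ≡⟨ cong (_* r) (sumFin≡sum f) ⟩
  sum f * r                   ≡⟨ *-distribʳ-sum r f ⟩
  sum (λ i → f i * r)         ≡⟨ sumFin≡sum (λ i → f i * r) ⟨
  sumFin (λ i → f i * r)      ∎
  where open ≡-Reasoning

sumFin-*-sumFin : (f : Fin m → ℕ) (g : Fin n → ℕ) →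
                  sumFin (λ i → sumFin (λ j → f i * g j)) ≡ sumFin f * sumFin g
sumFin-*-sumFin f g = begin
  sumFin (λ i → sumFin (λ j → f i * g j))  ≡⟨ sumFin-cong (λ i → *-distribˡ-sumFin (f i) g) ⟨
  sumFin (λ i → f i * sumFin g)            ≡⟨ *-distribʳ-sumFin (sumFin g) f ⟨
  sumFin f * sumFin g                      ∎
  where open ≡-Reasoning

sumFin-comm₂ : ∀ {m₁ m₂ n₁ n₂} (f : Fin m₁ → Fin m₂ → Fin n₁ → Fin n₂ → ℕ) →
  sumFin (λ i → sumFin (λ j → sumFin (λ k → sumFin (λ l → f i j k l)))) ≡
  sumFin (λ k → sumFin (λ l → sumFin (λ i → sumFin (λ j → f i j k l))))
sumFin-comm₂ f = begin
  sumFin (λ i → sumFin (λ j → sumFin (λ k → sumFin (λ l → f i j k l))))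
    ≡⟨ sumFin-cong (λ i → sumFin-comm (λ j k → sumFin (f i j k))) ⟩
  sumFin (λ i → sumFin (λ k → sumFin (λ j → sumFin (λ l → f i j k l))))
    ≡⟨ sumFin-comm (λ i k → sumFin (λ j → sumFin (f i j k))) ⟩
  sumFin (λ k → sumFin (λ i → sumFin (λ j → sumFin (λ l → f i j k l))))
    ≡⟨ sumFin-cong (λ k → sumFin-cong (λ i → sumFin-comm (λ j l → f i j k l))) ⟩
  sumFin (λ k → sumFin (λ i → sumFin (λ l → sumFin (λ j → f i j k l))))
    ≡⟨ sumFin-cong (λ k → sumFin-comm (λ i l → sumFin (λ j → f i j k l))) ⟩
  sumFin (λ k → sumFin (λ l → sumFin (λ i → sumFin (λ j → f i j k l))))  ∎
  where open ≡-Reasoning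

≤-maxFin : (f : Fin n → ℕ) (i : Fin n) → f i ≤ maxFin f
≤-maxFin f zero    = ℕP.m≤m⊔n (f zero) _
≤-maxFin f (suc i) = ℕP.≤-trans (≤-maxFin (f ∘ suc) i) (ℕP.m≤n⊔m (f zero) _)

==-refl : (i : Fin n) → (i == i) ≡ true
==-refl i with i ≟ i
... | yes _   = refl
... | no i≢i = ⊥-elim (i≢i refl)

==⇒≡ : {i j : Fin n} → (i == j) ≡ true → i ≡ j
==⇒≡ {i = i} {j} i==j with i ≟ j
... | yes i≡j = i≡j
==⇒≡ () | no _

==-∧-subst : (i j : Fin n) (f : Fin n → Bool) → (i == j) ∧ f i ≡ (i == j) ∧ f j
==-∧-subst i j f with i ≟ j
... | yes refl = refl
... | no _     = refl

eqPair⇒≡ : ∀ {k q} {α β : Fin k × Fin q} → eqPair α β ≡ true → α ≡ β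
eqPair⇒≡ {α = x , a} {y , b} eq =
  cong₂ _,_ (==⇒≡ (∧-conicalˡ _ _ eq)) (==⇒≡ (∧-conicalʳ (x == y) _ eq))

AtMostOne : (Fin n → Bool) → Set
AtMostOne p = ∀ {i j} → p i ≡ true → p j ≡ true → i ≡ j

anyFin-intro : (p : Fin n → Bool) (i : Fin n) → p i ≡ true → anyFin p ≡ true
anyFin-intro p zero    pi rewrite pi = refl
anyFin-intro p (suc i) pi rewrite anyFin-intro (p ∘ suc) i pi = ∨-zeroʳ (p zero)

anyFin-elim : (p : Fin n → Bool) → anyFin p ≡ true → ∃ λ i → p i ≡ true
anyFin-elim {suc n} p any with p zero in p0
... | true  = zero , p0
... | false = let i , pi = anyFin-elim (p ∘ suc) any in suc i , pi

⟦anyFin⟧ : (p : Fin n → Bool) → AtMostOne p → ⟦ anyFin p ⟧ ≡ countFin p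
⟦anyFin⟧ {zero}  p unique = refl
⟦anyFin⟧ {suc n} p unique with p zero in p0
... | true  = cong suc (sym (sumFin-zero absent))
  where
  absent : ∀ i → ⟦ p (suc i) ⟧ ≡ 0
  absent i with p (suc i) in pi
  ... | true  = case unique pi p0 of λ ()
  ... | false = refl
... | false = ⟦anyFin⟧ (p ∘ suc) (λ pi pj → FinP.suc-injective (unique pi pj))

countFin-unique : (p : Fin n → Bool) (i : Fin n) → p i ≡ true → AtMostOne p → countFin p ≡ 1
countFin-unique p i pi unique = trans (sym (⟦anyFin⟧ p unique)) (cong ⟦_⟧ (anyFin-intro p i pi))

[m%d+n]%d≡[m+n]%d : ∀ m n d .{{_ : NonZero d}} → (m % d + n) % d ≡ (m + n) % d
[m%d+n]%d≡[m+n]%d m n d = begin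
  (m % d + n) % d          ≡⟨ %-distribˡ-+ (m % d) n d ⟩
  (m % d % d + n % d) % d  ≡⟨ cong (λ r → (r + n % d) % d) (m%n%n≡m%n m d) ⟩
  (m % d + n % d) % d      ≡⟨ %-distribˡ-+ m n d ⟨
  (m + n) % d              ∎
  where open ≡-Reasoning

module Cyclic {q : ℕ} .{{_ : NonZero q}} where

  infixl 6 _⊕_ _⊖_

  _⊕_ : Fin q → Fin q → Fin q
  i ⊕ j = (toℕ i + toℕ j) mod q

  _⊖_ : Fin q → Fin q → Fin q
  i ⊖ j = (toℕ i + (q ∸ toℕ j)) mod q

  private
    toℕ-mod : ∀ m → toℕ (m mod q) ≡ m % q
    toℕ-mod m = FinP.toℕ-fromℕ< _

    toℕ%q : (i : Fin q) → toℕ i % q ≡ toℕ i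
    toℕ%q i = m<n⇒m%n≡m (FinP.toℕ<n i)

    +-∸-cancel : (i j : Fin q) → (toℕ j + (toℕ i + (q ∸ toℕ j))) % q ≡ toℕ i
    +-∸-cancel i j = begin
      (toℕ j + (toℕ i + (q ∸ toℕ j))) % q  ≡⟨ cong (_% q) (rearrange (toℕ i) (toℕ j) (q ∸ toℕ j)) ⟩
      (toℕ i + (toℕ j + (q ∸ toℕ j))) % q  ≡⟨ cong (λ r → (toℕ i + r) % q) (ℕP.m+[n∸m]≡n (ℕP.<⇒≤ (FinP.toℕ<n j))) ⟩
      (toℕ i + q) % q                      ≡⟨ [m+n]%n≡m%n (toℕ i) q ⟩
      toℕ i % q                            ≡⟨ toℕ%q i ⟩
      toℕ i                                ∎
      where
      open ≡-Reasoning
      rearrange : ∀ a b c → b + (a + c) ≡ a + (b + c)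
      rearrange = solve-∀

  ⊕-comm : (i j : Fin q) → i ⊕ j ≡ j ⊕ i
  ⊕-comm i j = cong (_mod q) (ℕP.+-comm (toℕ i) (toℕ j))

  ⊕-⊖ : (i j : Fin q) → j ⊕ (i ⊖ j) ≡ i
  ⊕-⊖ i j = FinP.toℕ-injective (begin
    toℕ (j ⊕ (i ⊖ j))                        ≡⟨ toℕ-mod _ ⟩
    (toℕ j + toℕ (i ⊖ j)) % q                ≡⟨ cong (λ r → (toℕ j + r) % q) (toℕ-mod _) ⟩
    (toℕ j + (toℕ i + (q ∸ toℕ j)) % q) % q  ≡⟨ cong (_% q) (ℕP.+-comm (toℕ j) _) ⟩
    ((toℕ i + (q ∸ toℕ j)) % q + toℕ j) % q  ≡⟨ [m%d+n]%d≡[m+n]%d _ (toℕ j) q ⟩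
    (toℕ i + (q ∸ toℕ j) + toℕ j) % q        ≡⟨ cong (_% q) (ℕP.+-comm _ (toℕ j)) ⟩
    (toℕ j + (toℕ i + (q ∸ toℕ j))) % q      ≡⟨ +-∸-cancel i j ⟩
    toℕ i                                    ∎)
    where open ≡-Reasoning

  ⊖-⊕ : (i j : Fin q) → (j ⊕ i) ⊖ j ≡ i
  ⊖-⊕ i j = FinP.toℕ-injective (begin
    toℕ ((j ⊕ i) ⊖ j)                        ≡⟨ toℕ-mod _ ⟩
    (toℕ (j ⊕ i) + (q ∸ toℕ j)) % q          ≡⟨ cong (λ r → (r + (q ∸ toℕ j)) % q) (toℕ-mod _) ⟩
    ((toℕ j + toℕ i) % q + (q ∸ toℕ j)) % q  ≡⟨ [m%d+n]%d≡[m+n]%d (toℕ j + toℕ i) _ q ⟩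
    (toℕ j + toℕ i + (q ∸ toℕ j)) % q        ≡⟨ cong (_% q) (ℕP.+-assoc (toℕ j) _ _) ⟩
    (toℕ j + (toℕ i + (q ∸ toℕ j))) % q      ≡⟨ +-∸-cancel i j ⟩
    toℕ i                                    ∎)
    where open ≡-Reasoning

  ⊕-cancelˡ : (i : Fin q) {j j′ : Fin q} → i ⊕ j ≡ i ⊕ j′ → j ≡ j′
  ⊕-cancelˡ i {j} {j′} eq = begin
    j            ≡⟨ ⊖-⊕ j i ⟨
    (i ⊕ j) ⊖ i   ≡⟨ cong (_⊖ i) eq ⟩
    (i ⊕ j′) ⊖ i  ≡⟨ ⊖-⊕ j′ i ⟩
    j′           ∎
    where open ≡-Reasoning

  ⊕-cancelʳ : {i i′ : Fin q} (j : Fin q) → i ⊕ j ≡ i′ ⊕ j → i ≡ i′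
  ⊕-cancelʳ {i} {i′} j eq = ⊕-cancelˡ j (trans (⊕-comm j i) (trans eq (⊕-comm i′ j)))

  countFin-⊕ : (i a : Fin q) → countFin (λ c → (i ⊕ c) == a) ≡ 1
  countFin-⊕ i a = countFin-unique (λ c → (i ⊕ c) == a) (a ⊖ i)
    (subst (λ b → (b == a) ≡ true) (sym (⊕-⊖ a i)) (==-refl a))
    (λ hit hit′ → ⊕-cancelˡ i (trans (==⇒≡ hit) (sym (==⇒≡ hit′))))

rank : ∀ {k} → (Fin n → Fin k) → Fin n → ℕ
rank {suc n} p zero    = 0
rank {suc n} p (suc u) = ⟦ p zero == p (suc u) ⟧ + rank (p ∘ suc) u

rank<countFin : ∀ {k} (p : Fin n → Fin k) (u : Fin n) → rank p u < countFin (λ v → p v == p u)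
rank<countFin {suc n} p zero    rewrite ==-refl (p zero) = ℕ.z<s
rank<countFin {suc n} p (suc u) = ℕP.+-monoʳ-< ⟦ p zero == p (suc u) ⟧ (rank<countFin (p ∘ suc) u)

rank-injective : ∀ {k} (p : Fin n → Fin k) {u v : Fin n} → p u ≡ p v → rank p u ≡ rank p v → u ≡ v
rank-injective {suc n} p {zero}  {zero}  _     _    = refl
rank-injective {suc n} p {zero}  {suc v} pu≡pv rank≡ rewrite pu≡pv | ==-refl (p (suc v)) = case rank≡ of λ ()
rank-injective {suc n} p {suc u} {zero}  pu≡pv rank≡ rewrite pu≡pv | ==-refl (p zero) = case rank≡ of λ ()
rank-injective {suc n} p {suc u} {suc v} pu≡pv rank≡ rewrite pu≡pv =
  cong suc (rank-injective (p ∘ suc) pu≡pv (ℕP.+-cancelˡ-≡ _ _ _ rank≡))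

sumList-map-concat-tabulate : ∀ {A : Set} (f : A → ℕ) (g : Fin n → List A) →
  sumList (map f (concat (tabulate g))) ≡ sumFin (λ i → sumList (map f (g i)))
sumList-map-concat-tabulate {zero}  f g = refl
sumList-map-concat-tabulate {suc n} f g = begin
  sumList (map f (g zero ++ concat (tabulate (g ∘ suc))))
    ≡⟨ cong sumList (ListP.map-++ f (g zero) _) ⟩
  sumList (map f (g zero) ++ map f (concat (tabulate (g ∘ suc))))
    ≡⟨ sumList-++ (map f (g zero)) _ ⟩
  sumList (map f (g zero)) + sumList (map f (concat (tabulate (g ∘ suc))))
    ≡⟨ cong (sumList (map f (g zero)) +_) (sumList-map-concat-tabulate f (g ∘ suc)) ⟩
  sumFin (λ i → sumList (map f (g i)))  ∎
  where open ≡-Reasoning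

module AllFunctions {q : ℕ} where

  sumFun : ∀ m → ((Fin m → Fin q) → ℕ) → ℕ
  sumFun zero    f = f (λ ())
  sumFun (suc m) f = sumFin (λ c → sumFun m (λ t → f (c V.∷ t)))

  allFunctions : ∀ m → List (Fin m → Fin q)
  allFunctions zero    = [ (λ ()) ]
  allFunctions (suc m) = concat (tabulate (λ c → map (c V.∷_) (allFunctions m)))

  sumFun-cong : ∀ m {f g : (Fin m → Fin q) → ℕ} → (∀ t → f t ≡ g t) → sumFun m f ≡ sumFun m g
  sumFun-cong zero    f≗g = f≗g _
  sumFun-cong (suc m) f≗g = sumFin-cong (λ c → sumFun-cong m (λ t → f≗g (c V.∷ t)))

  sum-map-allFunctions : ∀ m (f : (Fin m → Fin q) → ℕ) → sumList (map f (allFunctions m)) ≡ sumFun m f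
  sum-map-allFunctions zero    f = ℕP.+-identityʳ _
  sum-map-allFunctions (suc m) f = begin
    sumList (map f (concat (tabulate (λ c → map (c V.∷_) (allFunctions m)))))
      ≡⟨ sumList-map-concat-tabulate f (λ c → map (c V.∷_) (allFunctions m)) ⟩
    sumFin (λ c → sumList (map f (map (c V.∷_) (allFunctions m))))
      ≡⟨ sumFin-cong (λ c → cong sumList (ListP.map-∘ {g = f} {f = c V.∷_} (allFunctions m))) ⟨
    sumFin (λ c → sumList (map (λ t → f (c V.∷ t)) (allFunctions m)))
      ≡⟨ sumFin-cong (λ c → sum-map-allFunctions m (λ t → f (c V.∷ t))) ⟩
    sumFun (suc m) f  ∎
    where open ≡-Reasoning

  sumFun-const : ∀ m r → sumFun m (λ _ → r) ≡ q ^ m * r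
  sumFun-const zero    r = sym (ℕP.*-identityˡ r)
  sumFun-const (suc m) r = begin
    sumFin {q} (λ _ → sumFun m (λ _ → r))  ≡⟨ sumFin-cong {q} (λ _ → sumFun-const m r) ⟩
    sumFin {q} (λ _ → q ^ m * r)           ≡⟨ sumFin-const {q} (q ^ m * r) ⟩
    q * (q ^ m * r)                        ≡⟨ ℕP.*-assoc q (q ^ m) r ⟨
    q * q ^ m * r                          ∎
    where open ≡-Reasoning

  sumFun-coordinate : ∀ m (x : Fin m) (h : Fin q → ℕ) → sumFun m (λ t → h (t x)) * q ≡ q ^ m * sumFin h
  sumFun-coordinate (suc m) zero h = begin
    sumFin {q} (λ c → sumFun m (λ _ → h c)) * q  ≡⟨ cong (_* q) (sumFin-cong {q} (λ c → sumFun-const m (h c))) ⟩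
    sumFin {q} (λ c → q ^ m * h c) * q           ≡⟨ cong (_* q) (*-distribˡ-sumFin (q ^ m) h) ⟨
    q ^ m * sumFin h * q                         ≡⟨ rearrange (q ^ m) (sumFin h) q ⟩
    q * q ^ m * sumFin h                         ∎
    where
    open ≡-Reasoning
    rearrange : ∀ a b c → a * b * c ≡ c * a * b
    rearrange = solve-∀
  sumFun-coordinate (suc m) (suc x) h = begin
    sumFin {q} (λ _ → S) * q  ≡⟨ cong (_* q) (sumFin-const {q} S) ⟩
    q * S * q                 ≡⟨ ℕP.*-assoc q S q ⟩
    q * (S * q)               ≡⟨ cong (q *_) (sumFun-coordinate m x h) ⟩
    q * (q ^ m * sumFin h)    ≡⟨ ℕP.*-assoc q (q ^ m) _ ⟨
    q * q ^ m * sumFin h      ∎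
    where
    open ≡-Reasoning
    S : ℕ
    S = sumFun m (λ t → h (t x))

  sumFun-coordinates : ∀ m {x y : Fin m} → x ≢ y → (g : Fin q → Fin q → ℕ) →
    sumFun m (λ t → g (t x) (t y)) * (q * q) ≡ q ^ m * sumFin {q} (λ c → sumFin (g c))
  sumFun-coordinates (suc m) {zero}  {zero}  0≢0 g = ⊥-elim (0≢0 refl)
  sumFun-coordinates (suc m) {zero}  {suc y} _   g = begin
    sumFin S * (q * q)                           ≡⟨ ℕP.*-assoc (sumFin S) q q ⟨
    sumFin S * q * q                             ≡⟨ cong (_* q) (*-distribʳ-sumFin q S) ⟩
    sumFin {q} (λ c → S c * q) * q               ≡⟨ cong (_* q) (sumFin-cong {q} (λ c → sumFun-coordinate m y (g c))) ⟩
    sumFin {q} (λ c → q ^ m * sumFin (g c)) * q  ≡⟨ cong (_* q) (*-distribˡ-sumFin {q} (q ^ m) _) ⟨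
    q ^ m * sumFin {q} (λ c → sumFin (g c)) * q  ≡⟨ rearrange (q ^ m) _ q ⟩
    q * q ^ m * sumFin {q} (λ c → sumFin (g c))  ∎
    where
    open ≡-Reasoning
    S : Fin q → ℕ
    S c = sumFun m (λ t → g c (t y))
    rearrange : ∀ a b c → a * b * c ≡ c * a * b
    rearrange = solve-∀
  sumFun-coordinates (suc m) {suc x} {zero}  x≢y g = begin
    sumFun (suc m) (λ t → g (t (suc x)) (t zero)) * (q * q)  ≡⟨ sumFun-coordinates (suc m) (x≢y ∘ sym) (flip g) ⟩
    q ^ suc m * sumFin {q} (λ d → sumFin {q} (λ c → g c d))  ≡⟨ cong (q ^ suc m *_) (sumFin-comm (flip g)) ⟩
    q ^ suc m * sumFin {q} (λ c → sumFin (g c))              ∎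
    where open ≡-Reasoning
  sumFun-coordinates (suc m) {suc x} {suc y} x≢y g = begin
    sumFin {q} (λ _ → S) * (q * q)                 ≡⟨ cong (_* (q * q)) (sumFin-const {q} S) ⟩
    q * S * (q * q)                                ≡⟨ ℕP.*-assoc q S (q * q) ⟩
    q * (S * (q * q))                              ≡⟨ cong (q *_) (sumFun-coordinates m (x≢y ∘ cong suc) g) ⟩
    q * (q ^ m * sumFin {q} (λ c → sumFin (g c)))  ≡⟨ ℕP.*-assoc q (q ^ m) _ ⟨
    q * q ^ m * sumFin {q} (λ c → sumFin (g c))    ∎
    where
    open ≡-Reasoning
    S : ℕ
    S = sumFun m (λ t → g (t x) (t y))

mkℚᵘ-+ : ∀ a b → mkℚᵘ (ℤ.+ (a + b)) 0 ≃ mkℚᵘ (ℤ.+ a) 0 ℚᵘ.+ mkℚᵘ (ℤ.+ b) 0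
mkℚᵘ-+ a b = *≡* (begin
  ℤ.+ (a + b) ℤ.* 1ℤ                  ≡⟨ cong (ℤ._* 1ℤ) (ℤP.pos-+ a b) ⟩
  (ℤ.+ a ℤ.+ ℤ.+ b) ℤ.* 1ℤ            ≡⟨ rearrange (ℤ.+ a) (ℤ.+ b) ⟩
  (ℤ.+ a ℤ.* 1ℤ ℤ.+ ℤ.+ b ℤ.* 1ℤ) ℤ.* 1ℤ  ∎)
  where
  open ≡-Reasoning
  rearrange : ∀ x y → (x ℤ.+ y) ℤ.* 1ℤ ≡ (x ℤ.* 1ℤ ℤ.+ y ℤ.* 1ℤ) ℤ.* 1ℤ
  rearrange = ℤ-Solver.solve-∀

mkℚᵘ-*-cancel : ∀ N r d-1 e → N * r ≡ suc d-1 * e →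
                mkℚᵘ (ℤ.+ N) 0 ℚᵘ.* mkℚᵘ (ℤ.+ r) d-1 ≃ mkℚᵘ (ℤ.+ e) 0
mkℚᵘ-*-cancel N r d-1 e eq = *≡* (begin
  ℤ.+ N ℤ.* ℤ.+ r ℤ.* 1ℤ     ≡⟨ cong (ℤ._* 1ℤ) (ℤP.pos-* N r) ⟨
  ℤ.+ (N * r) ℤ.* 1ℤ         ≡⟨ cong (λ z → ℤ.+ z ℤ.* 1ℤ) eq ⟩
  ℤ.+ (d * e) ℤ.* 1ℤ         ≡⟨ cong (ℤ._* 1ℤ) (ℤP.pos-* d e) ⟩
  ℤ.+ d ℤ.* ℤ.+ e ℤ.* 1ℤ     ≡⟨ rearrange (ℤ.+ d) (ℤ.+ e) ⟩
  ℤ.+ e ℤ.* (1ℤ ℤ.* ℤ.+ d)   ≡⟨ cong (ℤ.+ e ℤ.*_) (ℤP.pos-* 1 d) ⟨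
  ℤ.+ e ℤ.* ℤ.+ (1 * d)      ∎)
  where
  open ≡-Reasoning
  d : ℕ
  d = suc d-1
  rearrange : ∀ x y → x ℤ.* y ℤ.* 1ℤ ≡ y ℤ.* (1ℤ ℤ.* x)
  rearrange = ℤ-Solver.solve-∀

toℚᵘ-/ : ∀ i d-1 → toℚᵘ (i / suc d-1) ≃ mkℚᵘ i d-1
toℚᵘ-/ i d-1 = ℚP.toℚᵘ-fromℚᵘ (mkℚᵘ i d-1)

ℕtoℚ-homo-+ : ∀ a b → ℕtoℚ (a + b) ≡ ℕtoℚ a +ℚ ℕtoℚ b
ℕtoℚ-homo-+ a b = ℚP.toℚᵘ-injective (begin
  toℚᵘ (ℕtoℚ (a + b))                     ≈⟨ toℚᵘ-/ (ℤ.+ (a + b)) 0 ⟩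
  mkℚᵘ (ℤ.+ (a + b)) 0                    ≈⟨ mkℚᵘ-+ a b ⟩
  mkℚᵘ (ℤ.+ a) 0 ℚᵘ.+ mkℚᵘ (ℤ.+ b) 0      ≈⟨ ℚᵘP.+-cong (toℚᵘ-/ (ℤ.+ a) 0) (toℚᵘ-/ (ℤ.+ b) 0) ⟨
  toℚᵘ (ℕtoℚ a) ℚᵘ.+ toℚᵘ (ℕtoℚ b)        ≈⟨ ℚP.toℚᵘ-homo-+ (ℕtoℚ a) (ℕtoℚ b) ⟨
  toℚᵘ (ℕtoℚ a +ℚ ℕtoℚ b)                 ∎)
  where open ℚᵘP.≃-Reasoning

ℕtoℚ-*-/ : ∀ N r d e .{{_ : NonZero d}} → N * r ≡ d * e → ℕtoℚ N *ℚ (ℤ.+ r / d) ≡ ℕtoℚ e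
ℕtoℚ-*-/ N r (suc d-1) e eq = ℚP.toℚᵘ-injective (begin
  toℚᵘ (ℕtoℚ N *ℚ (ℤ.+ r / suc d-1))          ≈⟨ ℚP.toℚᵘ-homo-* (ℕtoℚ N) (ℤ.+ r / suc d-1) ⟩
  toℚᵘ (ℕtoℚ N) ℚᵘ.* toℚᵘ (ℤ.+ r / suc d-1)   ≈⟨ ℚᵘP.*-cong (toℚᵘ-/ (ℤ.+ N) 0) (toℚᵘ-/ (ℤ.+ r) d-1) ⟩
  mkℚᵘ (ℤ.+ N) 0 ℚᵘ.* mkℚᵘ (ℤ.+ r) d-1        ≈⟨ mkℚᵘ-*-cancel N r d-1 e eq ⟩
  mkℚᵘ (ℤ.+ e) 0                              ≈⟨ toℚᵘ-/ (ℤ.+ e) 0 ⟨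
  toℚᵘ (ℕtoℚ e)                               ∎)
  where open ℚᵘP.≃-Reasoning

if-then-0ℚ : ∀ b c → (if b then c else 0ℚ) ≡ ℕtoℚ ⟦ b ⟧ *ℚ c
if-then-0ℚ true  c = sym (ℚP.*-identityˡ c)
if-then-0ℚ false c = sym (ℚP.*-zeroˡ c)

totalWeight-uniform : ∀ {n} {F : Graph n} {V : Set} {Q : NWGraph V} {A : Set} (eqV : V → V → Bool)
  (copy : A → WeightedCopy F Q) {c : ℚ} → (∀ a → weight (copy a) ≡ c) → ∀ α β (as : List A) →
  totalWeight eqV (map copy as) α β ≡ ℕtoℚ (sumList (map (λ a → ⟦ copyContains eqV (copy a) α β ⟧) as)) *ℚ c
totalWeight-uniform eqV copy {c} weight≡c α β []       = sym (ℚP.*-zeroˡ c)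
totalWeight-uniform {A = A} eqV copy {c} weight≡c α β (a ∷ as) = begin
  (if contains a then weight (copy a) else 0ℚ) +ℚ totalWeight eqV (map copy as) α β
    ≡⟨ cong₂ _+ℚ_ (if-then-0ℚ (contains a) (weight (copy a))) (totalWeight-uniform eqV copy weight≡c α β as) ⟩
  ℕtoℚ ⟦ contains a ⟧ *ℚ weight (copy a) +ℚ ℕtoℚ N *ℚ c
    ≡⟨ cong (λ z → ℕtoℚ ⟦ contains a ⟧ *ℚ z +ℚ ℕtoℚ N *ℚ c) (weight≡c a) ⟩
  ℕtoℚ ⟦ contains a ⟧ *ℚ c +ℚ ℕtoℚ N *ℚ c
    ≡⟨ ℚP.*-distribʳ-+ c (ℕtoℚ ⟦ contains a ⟧) (ℕtoℚ N) ⟨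
  (ℕtoℚ ⟦ contains a ⟧ +ℚ ℕtoℚ N) *ℚ c
    ≡⟨ cong (_*ℚ c) (ℕtoℚ-homo-+ ⟦ contains a ⟧ N) ⟨
  ℕtoℚ (⟦ contains a ⟧ + N) *ℚ c  ∎
  where
  open ≡-Reasoning
  contains : A → Bool
  contains a = copyContains eqV (copy a) α β
  N : ℕ
  N = sumList (map (⟦_⟧ ∘ contains) as)

module _ {n k : ℕ} {F : Graph n} (P : IndepPartition F k) where

  crossing : Fin k → Fin k → Fin n → Fin n → Bool
  crossing x y u v = adj F u v ∧ (part P u == x) ∧ (part P v == y)

  crossing-sound : ∀ {x y u v} → crossing x y u v ≡ true →
                   adj F u v ≡ true × part P u ≡ x × part P v ≡ y
  crossing-sound {x} {y} {u} {v} cross =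
    ∧-conicalˡ _ _ cross ,
    ==⇒≡ (∧-conicalˡ _ _ parts) ,
    ==⇒≡ (∧-conicalʳ (part P u == x) _ parts)
    where
    parts : (part P u == x) ∧ (part P v == y) ≡ true
    parts = ∧-conicalʳ (adj F u v) _ cross

  condWeight-diag : (x : Fin k) → condWeight P x x ≡ 0
  condWeight-diag x = sumFin-zero (λ u → sumFin-zero (λ v → cong ⟦_⟧ (¬-not (not-crossing u v))))
    where
    not-crossing : ∀ u v → crossing x x u v ≢ true
    not-crossing u v cross =
      let uv , pu≡x , pv≡x = crossing-sound cross in indep P u v uv (trans pu≡x (sym pv≡x))

  condWeight-edge : ∀ {u v} → adj F u v ≡ true → 0 < condWeight P (part P u) (part P v)
  condWeight-edge {u} {v} uv = ℕP.≤-trans (ℕP.≤-reflexive (sym crossing≡1))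
    (ℕP.≤-trans (≤-sumFin (λ v′ → ⟦ crossing (part P u) (part P v) u v′ ⟧) v)
                (≤-sumFin (λ u′ → countFin (crossing (part P u) (part P v) u′)) u))
    where
    crossing≡1 : ⟦ crossing (part P u) (part P v) u v ⟧ ≡ 1
    crossing≡1 rewrite uv | ==-refl (part P u) | ==-refl (part P v) = refl

module BlowUp {n k q : ℕ} .{{_ : NonZero q}} (F : Graph n) (P : IndepPartition F k)
  (partSize≤q : ∀ i → partSize P i ≤ q)
  (Q : NWGraph (Fin k × Fin q)) (Q≡blowUp : ∀ α β → w Q α β ≡ blowUpWeight (condWeight P) q α β)
  where

  open Cyclic
  open AllFunctions {q}

  slot : Fin n → Fin q
  slot u = fromℕ< (ℕP.<-≤-trans (rank<countFin (part P) u) (partSize≤q (part P u)))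

  slot-injective : ∀ {u v} → part P u ≡ part P v → slot u ≡ slot v → u ≡ v
  slot-injective pu≡pv slot≡ = rank-injective (part P) pu≡pv (FinP.fromℕ<-injective _ _ _ _ slot≡)

  embed : (Fin k → Fin q) → Fin n → Fin k × Fin q
  embed t u = part P u , slot u ⊕ t (part P u)

  embed-injective : ∀ t → Injective _≡_ _≡_ (embed t)
  embed-injective t {u} {v} embed≡ = slot-injective pu≡pv (⊕-cancelʳ (t (part P v))
    (subst (λ z → slot u ⊕ t z ≡ slot v ⊕ t (part P v)) pu≡pv slots≡))
    where
    pu≡pv : part P u ≡ part P v
    pu≡pv = proj₁ (,-injective embed≡)
    slots≡ : slot u ⊕ t (part P u) ≡ slot v ⊕ t (part P v)
    slots≡ = proj₂ (,-injective embed≡)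

  embed-hom : ∀ t {u v} → adj F u v ≡ true → w Q (embed t u) (embed t v) ≢ 0
  embed-hom t uv w≡0 = ℕP.n>0⇒n≢0 (condWeight-edge P uv) (trans (sym (Q≡blowUp _ _)) w≡0)

  instance
    q^k≢0 : NonZero (q ^ k)
    q^k≢0 = ℕP.m^n≢0 q k
    q*q≢0 : NonZero (q * q)
    q*q≢0 = ℕP.m*n≢0 q q

  copy : (Fin k → Fin q) → WeightedCopy F Q
  copy t = record
    { emb     = embed t
    ; emb-inj = embed-injective t
    ; emb-hom = λ u v → embed-hom t
    ; weight  = ℤ.+ (q * q) / q ^ k
    ; weight+ = ℚP.normalize-pos (q * q) (q ^ k)
    }

  hits : Fin n → Fin q → Fin q → Bool
  hits u a c = (slot u ⊕ c) == a

  eqPair-embed : ∀ t u x a → eqPair (embed t u) (x , a) ≡ (part P u == x) ∧ hits u a (t x)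
  eqPair-embed t u x a = ==-∧-subst (part P u) x (λ z → hits u a (t z))

  module _ (x : Fin k) (a : Fin q) (y : Fin k) (b : Fin q) where

    landsOn : Fin q → Fin q → Fin n → Fin n → ℕ
    landsOn c d u v = ⟦ crossing P x y u v ⟧ * (⟦ hits u a c ⟧ * ⟦ hits v b d ⟧)

    coveringEdges : Fin q → Fin q → ℕ
    coveringEdges c d = sumFin (λ u → sumFin (landsOn c d u))

    ⟦copyContains⟧ : ∀ t → ⟦ copyContains eqPair (copy t) (x , a) (y , b) ⟧ ≡ coveringEdges (t x) (t y)
    ⟦copyContains⟧ t = begin
      ⟦ anyFin (λ u → anyFin (λ v → maps u v)) ⟧     ≡⟨ ⟦anyFin⟧ _ unique-source ⟩
      sumFin (λ u → ⟦ anyFin (λ v → maps u v) ⟧)     ≡⟨ sumFin-cong (λ u → ⟦anyFin⟧ (maps u) unique-target) ⟩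
      sumFin (λ u → countFin (λ v → maps u v))       ≡⟨ sumFin-cong (λ u → sumFin-cong (λ v → ⟦maps⟧ u v)) ⟩
      coveringEdges (t x) (t y)                      ∎
      where
      open ≡-Reasoning
      maps : Fin n → Fin n → Bool
      maps u v = adj F u v ∧ eqPair (embed t u) (x , a) ∧ eqPair (embed t v) (y , b)

      maps-sound : ∀ {u v} → maps u v ≡ true → embed t u ≡ (x , a) × embed t v ≡ (y , b)
      maps-sound {u} {v} uv =
        eqPair⇒≡ (∧-conicalˡ _ _ ends) , eqPair⇒≡ (∧-conicalʳ (eqPair (embed t u) (x , a)) _ ends)
        where
        ends : eqPair (embed t u) (x , a) ∧ eqPair (embed t v) (y , b) ≡ true
        ends = ∧-conicalʳ (adj F u v) _ uv

      unique-target : ∀ {u} → AtMostOne (maps u)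
      unique-target uv uv′ = embed-injective t (trans (proj₂ (maps-sound uv)) (sym (proj₂ (maps-sound uv′))))

      unique-source : AtMostOne (λ u → anyFin (maps u))
      unique-source {u} {u′} any any′ =
        let _ , uv = anyFin-elim (maps u) any ; _ , uv′ = anyFin-elim (maps u′) any′
        in embed-injective t (trans (proj₁ (maps-sound uv)) (sym (proj₁ (maps-sound uv′))))

      ⟦maps⟧ : ∀ u v → ⟦ maps u v ⟧ ≡ ⟦ crossing P x y u v ⟧ * (⟦ hits u a (t x) ⟧ * ⟦ hits v b (t y) ⟧)
      ⟦maps⟧ u v rewrite eqPair-embed t u x a | eqPair-embed t v y b =
        ⟦∧⟧-interchange (adj F u v) (part P u == x) (hits u a (t x)) (part P v == y) (hits v b (t y))

    sum-coveringEdges : sumFin (λ c → sumFin (coveringEdges c)) ≡ condWeight P x y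
    sum-coveringEdges = trans (sumFin-comm₂ landsOn) (sumFin-cong (λ u → sumFin-cong (λ v → sum-landsOn u v)))
      where
      sum-landsOn : ∀ u v → sumFin (λ c → sumFin (λ d → landsOn c d u v)) ≡ ⟦ crossing P x y u v ⟧
      sum-landsOn u v = begin
        sumFin (λ c → sumFin (λ d → r * (⟦ hits u a c ⟧ * ⟦ hits v b d ⟧)))
          ≡⟨ sumFin-cong (λ c → *-distribˡ-sumFin r (λ d → ⟦ hits u a c ⟧ * ⟦ hits v b d ⟧)) ⟨
        sumFin (λ c → r * sumFin (λ d → ⟦ hits u a c ⟧ * ⟦ hits v b d ⟧))
          ≡⟨ *-distribˡ-sumFin r (λ c → sumFin (λ d → ⟦ hits u a c ⟧ * ⟦ hits v b d ⟧)) ⟨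
        r * sumFin (λ c → sumFin (λ d → ⟦ hits u a c ⟧ * ⟦ hits v b d ⟧))
          ≡⟨ cong (r *_) (sumFin-*-sumFin (⟦_⟧ ∘ hits u a) (⟦_⟧ ∘ hits v b)) ⟩
        r * (countFin (hits u a) * countFin (hits v b))
          ≡⟨ cong₂ (λ i j → r * (i * j)) (countFin-⊕ (slot u) a) (countFin-⊕ (slot v) b) ⟩
        r * 1
          ≡⟨ ℕP.*-identityʳ r ⟩
        r ∎
        where
        open ≡-Reasoning
        r : ℕ
        r = ⟦ crossing P x y u v ⟧

    copies-containing : x ≢ y →
      sumFun k (λ t → ⟦ copyContains eqPair (copy t) (x , a) (y , b) ⟧) * (q * q) ≡ q ^ k * condWeight P x y
    copies-containing x≢y = begin
      sumFun k (λ t → ⟦ copyContains eqPair (copy t) (x , a) (y , b) ⟧) * (q * q)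
        ≡⟨ cong (_* (q * q)) (sumFun-cong k ⟦copyContains⟧) ⟩
      sumFun k (λ t → coveringEdges (t x) (t y)) * (q * q)
        ≡⟨ sumFun-coordinates k x≢y coveringEdges ⟩
      q ^ k * sumFin (λ c → sumFin (coveringEdges c))
        ≡⟨ cong (q ^ k *_) sum-coveringEdges ⟩
      q ^ k * condWeight P x y  ∎
      where open ≡-Reasoning

  decomposition : FractionalDecomposition F Q eqPair
  decomposition = map copy (allFunctions k) , covers
    where
    covers : ∀ α β → w Q α β ≢ 0 → totalWeight eqPair (map copy (allFunctions k)) α β ≡ ℕtoℚ (w Q α β)
    covers (x , a) (y , b) w≢0 = begin
      totalWeight eqPair (map copy (allFunctions k)) (x , a) (y , b)
        ≡⟨ totalWeight-uniform eqPair copy (λ _ → refl) (x , a) (y , b) (allFunctions k) ⟩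
      ℕtoℚ (sumList (map contains (allFunctions k))) *ℚ (ℤ.+ (q * q) / q ^ k)
        ≡⟨ ℕtoℚ-*-/ (sumList (map contains (allFunctions k))) (q * q) (q ^ k) (condWeight P x y) count ⟩
      ℕtoℚ (condWeight P x y)
        ≡⟨ cong ℕtoℚ (Q≡blowUp (x , a) (y , b)) ⟨
      ℕtoℚ (w Q (x , a) (y , b))  ∎
      where
      open ≡-Reasoning
      contains : (Fin k → Fin q) → ℕ
      contains t = ⟦ copyContains eqPair (copy t) (x , a) (y , b) ⟧

      x≢y : x ≢ y
      x≢y refl = w≢0 (trans (Q≡blowUp (x , a) (x , b)) (condWeight-diag P x))

      count : sumList (map contains (allFunctions k)) * (q * q) ≡ q ^ k * condWeight P x y
      count = trans (cong (_* (q * q)) (sum-map-allFunctions k contains)) (copies-containing x a y b x≢y)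

blowUp-fractionalDecomposition : ∀ {n k} (F : Graph n) (P : IndepPartition F k) (q : ℕ) →
  (∀ i → partSize P i ≤ q) →
  (Q : NWGraph (Fin k × Fin q)) → (∀ α β → w Q α β ≡ blowUpWeight (condWeight P) q α β) →
  FractionalDecomposition F Q eqPair
blowUp-fractionalDecomposition F P zero    _          Q _        = [] , λ { (_ , ()) }
blowUp-fractionalDecomposition F P (suc q) partSize≤q Q Q≡blowUp = BlowUp.decomposition F P partSize≤q Q Q≡blowUp

lemma4p3 : ∀ {n k : ℕ} (F : Graph n) (P : IndepPartition F k)
    → (Q : NWGraph (Fin k × Fin (maxPartSize P)))
    → (∀ α β → w Q α β ≡ blowUpWeight (condWeight P) (maxPartSize P) α β)
    → FractionalDecomposition F Q eqPair
lemma4p3 F P = blowUp-fractionalDecomposition F P (maxPartSize P) (≤-maxFin (partSize P))
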